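{- Let $q=2mn+1$ be a prime power and let $A=(a_{i,j})$ be a rank-one Heffter array H$(m,n)$ over $\mathbb{F}_q$, with factors $X=\{x_1,\dots,x_m\}$ and $Y=\{y_1,\dots,y_n\}$, so that $a_{i,j}=x_iy_j$ for all $i,j$. Then the group of multipliers of $A$ is the product $S\cdot T$, where $S$ and $T$ are the stabilizers of $X$ and $Y$, respectively, under the multiplicative action of $\mathbb{F}_q^*$. Moreover, the order of the group of multipliers of $A$ is at most $\mathrm{lcm}(m_o,n_o)$.
   Context: A half-set of an additive group $G$ of odd order $2\ell+1$ is an $\ell$-subset $L$ with $L\cup -L=G\setminus\{0\}$. A Heffter array H$(m,n)$ over $\mathbb{F}_q$ (with $q=2mn+1$) is an $m\times n$ matrix over $\mathbb{F}_q$ whose entries form a half-set of the additive group of $\mathbb{F}_q$ and whose every row and column sums to $0$; it is rank-one if it has rank $1$ over $\mathbb{F}_q$. For a rank-one H$(m,n)$ $A$ there are sets $X=\{x_1,\dots,x_m\}$, $Y=\{y_1,\dots,y_n\}\subseteq\mathbb{F}_q^*$ with $a_{i,j}=x_iy_j$; these are called the factors of $A$. A multiplier of $A$ is an element $u\in\mathbb{F}_q^*$ such that $uA$ or $uA^T$ can be obtained from $A$ by permuting its rows and columns; multipliers form a subgroup of $\mathbb{F}_q^*$. For an integer $k$, $k_o$ denotes its odd part, the largest odd divisor of $k$. The stabilizer of a set $Z\subseteq\mathbb{F}_q^*$ is $\{u\in\mathbb{F}_q^*: uZ=Z\}$. -}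

module Defs where

open import Level using (0ℓ)
open import Data.Nat using (ℕ; zero; suc; _≤_; _^_; _/_; _%_)
open import Data.Nat.Primality using (Prime)
open import Data.Fin using (Fin; zero; suc)
open import Data.Product using (Σ; ∃; ∃-syntax; _×_; _,_)
open import Data.Sum using (_⊎_)
open import Data.List using (List; length)
open import Data.List.Membership.Propositional using (_∈_)
open import Data.List.Relation.Unary.All using (All)
open import Data.List.Relation.Unary.Unique.Propositional using (Unique)
open import Function.Bundles using (_↔_; Inverse)
open import Relation.Binary.PropositionalEquality using (_≡_; _≢_)
open import Algebra.Structures using (IsCommutativeRing)

IsPrimePower : ℕ → Set
IsPrimePower q = Σ ℕ λ p → Σ ℕ λ k → Prime p × 1 ≤ k × q ≡ p ^ k

-- odd part of a natural number: divide out factors 2 (fuel = n suffices)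
oddPartAux : ℕ → ℕ → ℕ
oddPartAux zero n = n
oddPartAux (suc f) zero = zero
oddPartAux (suc f) (suc k) with suc k % 2
... | zero = oddPartAux f (suc k / 2)
... | suc _ = suc k

oddPart : ℕ → ℕ
oddPart n = oddPartAux n n

-- A finite field with exactly q elements, realised on the carrier Fin q
-- (any field of order q is F_q up to isomorphism).
record FiniteField (q : ℕ) : Set where
  infixl 7 _*_
  infixl 6 _+_
  field
    _+_ _*_ : Fin q → Fin q → Fin q
    -_ : Fin q → Fin q
    0# 1# : Fin q
    isCommutativeRing : IsCommutativeRing _≡_ _+_ _*_ -_ 0# 1#
    0≢1 : 0# ≢ 1#
    inverse : ∀ x → x ≢ 0# → ∃[ y ] (x * y ≡ 1#)

module _ {q : ℕ} (𝔽 : FiniteField q) where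
  open FiniteField 𝔽

  sumF : ∀ {k} → (Fin k → Fin q) → Fin q
  sumF {zero} f = 0#
  sumF {suc k} f = f zero + sumF (λ i → f (suc i))

  IsHalfSet : ∀ {ℓ} → (Fin ℓ → Fin q) → Set
  IsHalfSet {ℓ} L =
    (∀ a b → L a ≡ L b → a ≡ b) ×
    (∀ g → (g ≢ 0# → ∃[ a ] (L a ≡ g ⊎ L a ≡ - g)) ×
           (∃[ a ] (L a ≡ g ⊎ L a ≡ - g) → g ≢ 0#))

  -- Heffter array H(m,n) over F_q (q = 2mn+1 assumed separately)
  IsHeffter : ∀ m n → (Fin m → Fin n → Fin q) → Set
  IsHeffter m n A =
    IsHalfSet {m Data.Nat.* n} (λ k → A (row k) (col k)) ×
    (∀ i → sumF (λ j → A i j) ≡ 0#) ×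
    (∀ j → sumF (λ i → A i j) ≡ 0#)
    where
      open import Data.Fin using (quotRem)
      open import Data.Product using (proj₁; proj₂)
      row : Fin (m Data.Nat.* n) → Fin m
      row k = proj₂ (quotRem {m} n k)
      col : Fin (m Data.Nat.* n) → Fin n
      col k = proj₁ (quotRem {m} n k)

  IsMultiplier : ∀ {m n} → (Fin m → Fin n → Fin q) → Fin q → Set
  IsMultiplier {m} {n} A u =
    u ≢ 0# ×
    ((Σ (Fin m ↔ Fin m) λ σ → Σ (Fin n ↔ Fin n) λ τ →
        ∀ i j → u * A i j ≡ A (Inverse.to σ i) (Inverse.to τ j))
     ⊎
     (Σ (Fin n ↔ Fin m) λ π → Σ (Fin m ↔ Fin n) λ ρ →
        ∀ i j → u * A i j ≡ A (Inverse.to π j) (Inverse.to ρ i)))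

  InStabilizer : ∀ {k} → (Fin k → Fin q) → Fin q → Set
  InStabilizer z u =
    u ≢ 0# ×
    (∀ i → ∃[ i' ] (u * z i ≡ z i')) ×
    (∀ i → ∃[ i' ] (z i ≡ u * z i'))

-- A multiplier u permutes the entries x i · y j, and cancelling along a fixed row and column
-- splits u = s · t with s · X = X and t · Y = Y (in the transposed case already u · X = X).
-- Conversely such s and t permute the rows and columns.  A stabilizer element s of X
-- permutes X, so comparing the products of X and s · X gives s ^ m ≡ 1.  Since A is a half-set,
-- -1 does not stabilize X, so the 2-part of the order of s is trivial and s ^ oddPart m ≡ 1.
-- Hence every multiplier is a root of x ^ lcm (oddPart m) (oddPart n) - 1, a polynomial with
-- at most lcm (oddPart m) (oddPart n) roots in a field.
module Submission where

open import Defs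
open import Data.Nat using (ℕ; suc; _*_; _≤_)
open import Data.Nat.LCM using (lcm)
open import Data.Fin using (Fin)
open import Data.Product using (Σ; _×_; _,_)
open import Data.List using (List; length)
open import Data.List.Relation.Unary.All using (All)
open import Data.List.Relation.Unary.Unique.Propositional using (Unique)
open import Function.Bundles using (_⇔_)
open import Relation.Binary.PropositionalEquality using (_≡_; _≢_)

import Data.Nat as ℕ
import Data.Nat.Properties as ℕ
open import Data.Nat using (zero; z≤n; s≤s)
open import Data.Nat.Divisibility using (_∣_; divides; m%n≡0⇒n∣m)
open import Data.Nat.DivMod using (m/n*n≡m)
open import Data.Nat.GCD using (gcd)
open import Data.Nat.LCM using (m∣lcm[m,n]; n∣lcm[m,n]; gcd*lcm)
open import Data.Fin using (zero; suc; _↑ˡ_; _↑ʳ_; splitAt; punchOut; combine; quotRem)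
open import Data.Fin.Properties
  using (injective⇒≤; punchOut-injective; splitAt-↑ˡ; splitAt-↑ʳ; remQuot-combine; combine-injective; suc-injective)
import Data.Fin as Fin
open import Data.Product using (proj₁; proj₂; ∃; ∃₂)
open import Data.Sum using (_⊎_; inj₁; inj₂; [_,_]′)
open import Data.Empty using (⊥-elim)
open import Data.List using ([]; _∷_; replicate)
open import Data.List.Properties using (length-replicate)
import Data.List.Relation.Unary.All as All
open import Data.List.Relation.Unary.AllPairs using ([]; _∷_)
open import Function using (_∘_)
open import Function.Bundles using (_↔_; Inverse; mk↔ₛ′; mk⇔)
open import Function.Construct.Composition using (_↔-∘_)
open import Function.Construct.Identity using (↔-id)
open import Function.Definitions using (Injective; StrictlySurjective)
open import Relation.Binary.PropositionalEquality using (refl; sym; trans; cong; cong₂; subst; module ≡-Reasoning)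
open import Relation.Nullary using (¬_; yes; no; contradiction)
open import Algebra.Bundles using (CommutativeRing)

open ≡-Reasoning

-- A surjection Fin k → Fin k with a collision would leave room for an injection Fin (suc k) → Fin k.
strictlySurjective⇒injective : ∀ {k k′} → k ≡ k′ → (f : Fin k → Fin k′) →
                               StrictlySurjective _≡_ f → Injective _≡_ _≡_ f
strictlySurjective⇒injective {zero}  refl f surj {()}
strictlySurjective⇒injective {suc k} refl f surj {i} {j} fi≡fj with i Fin.≟ j
... | yes i≡j = i≡j
... | no i≢j = contradiction (injective⇒≤ g-injective) ℕ.1+n≰n
  where
    preimage-avoiding-i : ∀ y → ∃ λ x → f x ≡ y × i ≢ x
    preimage-avoiding-i y with surj y
    ... | x , fx≡y with i Fin.≟ x
    ...   | yes refl = j , trans (sym fi≡fj) fx≡y , i≢j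
    ...   | no i≢x = x , fx≡y , i≢x

    g : Fin (suc k) → Fin k
    g y = punchOut (proj₂ (proj₂ (preimage-avoiding-i y)))

    g-injective : Injective _≡_ _≡_ g
    g-injective {y} {y′} gy≡gy′ = begin
      y                                     ≡⟨ proj₁ (proj₂ (preimage-avoiding-i y)) ⟨
      f (proj₁ (preimage-avoiding-i y))     ≡⟨ cong f (punchOut-injective {i = i} _ _ gy≡gy′) ⟩
      f (proj₁ (preimage-avoiding-i y′))    ≡⟨ proj₁ (proj₂ (preimage-avoiding-i y′)) ⟩
      y′                                    ∎

oddPartAux*2^≡ : ∀ fuel k → ∃ λ e → oddPartAux fuel k ℕ.* 2 ℕ.^ e ≡ k
oddPartAux*2^≡ zero k = 0 , ℕ.*-identityʳ k
oddPartAux*2^≡ (suc fuel) zero = 0 , refl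
oddPartAux*2^≡ (suc fuel) (suc k) with suc k ℕ.% 2 in k%2≡0
... | suc _ = 0 , ℕ.*-identityʳ (suc k)
... | zero with oddPartAux*2^≡ fuel (suc k ℕ./ 2)
...   | e , o*2^e≡k/2 = suc e , (begin
        o ℕ.* (2 ℕ.* 2 ℕ.^ e)      ≡⟨ cong (o ℕ.*_) (ℕ.*-comm 2 (2 ℕ.^ e)) ⟩
        o ℕ.* (2 ℕ.^ e ℕ.* 2)      ≡⟨ ℕ.*-assoc o (2 ℕ.^ e) 2 ⟨
        o ℕ.* 2 ℕ.^ e ℕ.* 2        ≡⟨ cong (ℕ._* 2) o*2^e≡k/2 ⟩
        suc k ℕ./ 2 ℕ.* 2          ≡⟨ m/n*n≡m (m%n≡0⇒n∣m (suc k) 2 k%2≡0) ⟩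
        suc k                      ∎)
  where
    o : ℕ
    o = oddPartAux fuel (suc k ℕ./ 2)

oddPart*2^≡ : ∀ k → ∃ λ e → oddPart k ℕ.* 2 ℕ.^ e ≡ k
oddPart*2^≡ k = oddPartAux*2^≡ k k

oddPart≢0 : ∀ {k} → k ≢ 0 → oddPart k ≢ 0
oddPart≢0 {k} k≢0 oddPart≡0 with oddPart*2^≡ k
... | e , o*2^e≡k = k≢0 (trans (sym o*2^e≡k) (cong (ℕ._* 2 ℕ.^ e) oddPart≡0))

lcm≢0 : ∀ {a b} → a ≢ 0 → b ≢ 0 → lcm a b ≢ 0
lcm≢0 {a} {b} a≢0 b≢0 lcm≡0
  with ℕ.m*n≡0⇒m≡0∨n≡0 a (trans (sym (gcd*lcm a b)) (trans (cong (gcd a b ℕ.*_) lcm≡0) (ℕ.*-zeroʳ (gcd a b))))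
... | inj₁ a≡0 = a≢0 a≡0
... | inj₂ b≡0 = b≢0 b≡0

no-field-of-order-1 : ∀ {q} → q ≡ 1 → ¬ FiniteField q
no-field-of-order-1 refl 𝔽 = FiniteField.0≢1 𝔽 (trans (only-zero _) (sym (only-zero _)))
  where
    only-zero : (i : Fin 1) → i ≡ zero
    only-zero zero = refl

module FieldProperties {q : ℕ} (𝔽 : FiniteField q) where
  open FiniteField 𝔽 using (_+_; -_; 0#; 1#; isCommutativeRing; 0≢1; inverse) renaming (_*_ to _·_)

  ring : CommutativeRing _ _
  ring = record { isCommutativeRing = isCommutativeRing }

  open CommutativeRing ring
    using (*-comm; *-assoc; *-identityˡ; *-identityʳ; zeroˡ; zeroʳ; +-identityʳ; -‿inverseʳ;
           +-abelianGroup; *-commutativeMonoid; *-commutativeSemigroup; commutativeSemiring)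
    renaming (ring to ringᵘ)
  open import Algebra.Properties.Ring ringᵘ using (-1*x≈-x; -‿distribˡ-*; -‿distribʳ-*)
  open import Algebra.Properties.AbelianGroup +-abelianGroup using (inverseˡ-unique; x∙y⁻¹≈ε⇒x≈y; ⁻¹-involutive)
  open import Algebra.Properties.CommutativeSemigroup *-commutativeSemigroup using (interchange)
  open import Algebra.Properties.CommutativeSemiring.Exp commutativeSemiring using (_^_; ^-assocʳ; ^-distrib-*)
  open import Algebra.Properties.CommutativeMonoid.Sum *-commutativeMonoid
    using (∑-distrib-+; sum-replicate; sum-permute; sum-cong-≗) renaming (sum to product)
  open import Algebra.Solver.Ring.NaturalCoefficients.Default commutativeSemiring using (solve; _:=_; _:+_; _:*_)

  F : Set
  F = Fin q

  1#≢0# : 1# ≢ 0#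
  1#≢0# = 0≢1 ∘ sym

  ·-cancelʳ : ∀ {x y z} → z ≢ 0# → x · z ≡ y · z → x ≡ y
  ·-cancelʳ {x} {y} {z} z≢0 xz≡yz with inverse z z≢0
  ... | z⁻¹ , zz⁻¹≡1 = begin
    x                ≡⟨ *-identityʳ x ⟨
    x · 1#           ≡⟨ cong (x ·_) zz⁻¹≡1 ⟨
    x · (z · z⁻¹)    ≡⟨ *-assoc x z z⁻¹ ⟨
    x · z · z⁻¹      ≡⟨ cong (_· z⁻¹) xz≡yz ⟩
    y · z · z⁻¹      ≡⟨ *-assoc y z z⁻¹ ⟩
    y · (z · z⁻¹)    ≡⟨ cong (y ·_) zz⁻¹≡1 ⟩
    y · 1#           ≡⟨ *-identityʳ y ⟩
    y                ∎

  ·-cancelˡ : ∀ {x y z} → z ≢ 0# → z · x ≡ z · y → x ≡ y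
  ·-cancelˡ {x} {y} {z} z≢0 zx≡zy = ·-cancelʳ z≢0 (trans (*-comm x z) (trans zx≡zy (*-comm z y)))

  x·y≡0⇒x≡0∨y≡0 : ∀ {x y} → x · y ≡ 0# → x ≡ 0# ⊎ y ≡ 0#
  x·y≡0⇒x≡0∨y≡0 {x} {y} xy≡0 with x Fin.≟ 0#
  ... | yes x≡0 = inj₁ x≡0
  ... | no x≢0 = inj₂ (·-cancelˡ x≢0 (trans xy≡0 (sym (zeroʳ x))))

  ·-nonZero : ∀ {x y} → x ≢ 0# → y ≢ 0# → x · y ≢ 0#
  ·-nonZero x≢0 y≢0 xy≡0 = [ x≢0 , y≢0 ]′ (x·y≡0⇒x≡0∨y≡0 xy≡0)

  x·y≢0⇒x≢0 : ∀ {x y} → x · y ≢ 0# → x ≢ 0#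
  x·y≢0⇒x≢0 {x} {y} xy≢0 x≡0 = xy≢0 (trans (cong (_· y) x≡0) (zeroˡ y))

  quotient : ∀ {a} → a ≢ 0# → ∀ b → ∃ λ s → s · a ≡ b
  quotient {a} a≢0 b with inverse a a≢0
  ... | a⁻¹ , aa⁻¹≡1 = b · a⁻¹ , (begin
    b · a⁻¹ · a      ≡⟨ *-assoc b a⁻¹ a ⟩
    b · (a⁻¹ · a)    ≡⟨ cong (b ·_) (trans (*-comm a⁻¹ a) aa⁻¹≡1) ⟩
    b · 1#           ≡⟨ *-identityʳ b ⟩
    b                ∎)

  x·x≡1⇒x≡±1 : ∀ w → w · w ≡ 1# → w ≡ 1# ⊎ w ≡ - 1#
  x·x≡1⇒x≡±1 w ww≡1 with x·y≡0⇒x≡0∨y≡0 product≡0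
    where
      product≡0 : (w + - 1#) · (w + 1#) ≡ 0#
      product≡0 = begin
        (w + - 1#) · (w + 1#)                         ≡⟨ solve 3 (λ w b e →
            (w :+ b) :* (w :+ e) := (w :* w :+ b :* e) :+ (e :+ b) :* w) refl w (- 1#) 1# ⟩
        (w · w + - 1# · 1#) + (1# + - 1#) · w         ≡⟨ cong₂ (λ a b → a + - 1# · 1# + b · w) ww≡1 (-‿inverseʳ 1#) ⟩
        (1# + - 1# · 1#) + 0# · w                     ≡⟨ cong₂ (λ a b → 1# + a + b) (*-identityʳ (- 1#)) (zeroˡ w) ⟩
        (1# + - 1#) + 0#                              ≡⟨ +-identityʳ _ ⟩
        1# + - 1#                                     ≡⟨ -‿inverseʳ 1# ⟩
        0#                                            ∎
  ... | inj₁ w-1≡0 = inj₁ (x∙y⁻¹≈ε⇒x≈y w 1# w-1≡0)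
  ... | inj₂ w+1≡0 = inj₂ (inverseˡ-unique w 1# w+1≡0)

  1#^n≡1# : ∀ n → 1# ^ n ≡ 1#
  1#^n≡1# zero = refl
  1#^n≡1# (suc n) = trans (*-identityˡ (1# ^ n)) (1#^n≡1# n)

  ^≡1⇒^multiple≡1 : ∀ {s} k {N} → s ^ k ≡ 1# → k ∣ N → s ^ N ≡ 1#
  ^≡1⇒^multiple≡1 {s} k s^k≡1 (divides c refl) = begin
    s ^ (c ℕ.* k)     ≡⟨ cong (s ^_) (ℕ.*-comm c k) ⟩
    s ^ (k ℕ.* c)     ≡⟨ ^-assocʳ s k c ⟨
    (s ^ k) ^ c       ≡⟨ cong (_^ c) s^k≡1 ⟩
    1# ^ c            ≡⟨ 1#^n≡1# c ⟩
    1#                ∎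

  -- evalMonic cs is the monic polynomial of degree length cs whose lower coefficients are cs,
  -- constant term first, evaluated by Horner's rule.
  evalMonic : List F → F → F
  evalMonic []       x = 1#
  evalMonic (c ∷ cs) x = x · evalMonic cs x + c

  -- Adding (a + - a) · r turns the identities below into semiring identities in a and b = - a.
  +-pad : ∀ a r z → z ≡ z + (a + - a) · r
  +-pad a r z = begin
    z                   ≡⟨ +-identityʳ z ⟨
    z + 0#              ≡⟨ cong (z +_) (zeroˡ r) ⟨
    z + 0# · r          ≡⟨ cong (λ c → z + c · r) (-‿inverseʳ a) ⟨
    z + (a + - a) · r   ∎

  factor-theorem : ∀ a c cs → ∃ λ ds → length ds ≡ length cs ×
                   (∀ x → evalMonic (c ∷ cs) x ≡ (x + - a) · evalMonic ds x + evalMonic (c ∷ cs) a)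
  factor-theorem a c [] = [] , refl , λ x → trans (+-pad a 1# _)
    (solve 5 (λ x a b c e → x :* e :+ c :+ (a :+ b) :* e := (x :+ b) :* e :+ (a :* e :+ c)) refl x a (- a) c 1#)
  factor-theorem a c (c′ ∷ cs) with factor-theorem a c′ cs
  ... | ds , |ds|≡|cs| , p′≡ = r ∷ ds , cong suc |ds|≡|cs| , λ x → begin
      x · evalMonic (c′ ∷ cs) x + c                              ≡⟨ cong (λ p → x · p + c) (p′≡ x) ⟩
      x · ((x + - a) · evalMonic ds x + r) + c                   ≡⟨ +-pad a r _ ⟩
      x · ((x + - a) · evalMonic ds x + r) + c + (a + - a) · r   ≡⟨ solve 6 (λ x a b Q r c →
          x :* ((x :+ b) :* Q :+ r) :+ c :+ (a :+ b) :* r := (x :+ b) :* (x :* Q :+ r) :+ (a :* r :+ c))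
          refl x a (- a) (evalMonic ds x) r c ⟩
      (x + - a) · (x · evalMonic ds x + r) + (a · r + c)         ∎
    where
      r : F
      r = evalMonic (c′ ∷ cs) a

  roots≤degree : ∀ cs (us : List F) → Unique us → All (λ u → evalMonic cs u ≡ 0#) us → length us ≤ length cs
  roots≤degree cs       []       _              _                = z≤n
  roots≤degree []       (u ∷ us) _              (1≡0 All.∷ _)    = contradiction 1≡0 1#≢0#
  roots≤degree (c ∷ cs) (u ∷ us) (u∉us ∷ uniq) (pu≡0 All.∷ pus≡0) with factor-theorem u c cs
  ... | ds , |ds|≡|cs| , p≡ =
    s≤s (subst (length us ≤_) |ds|≡|cs| (roots≤degree ds us uniq (All.zipWith root-of-quotient (u∉us , pus≡0))))
    where
      root-of-quotient : ∀ {v} → u ≢ v × evalMonic (c ∷ cs) v ≡ 0# → evalMonic ds v ≡ 0#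
      root-of-quotient {v} (u≢v , pv≡0) with x·y≡0⇒x≡0∨y≡0 (begin
        (v + - u) · evalMonic ds v                              ≡⟨ +-identityʳ _ ⟨
        (v + - u) · evalMonic ds v + 0#                         ≡⟨ cong ((v + - u) · evalMonic ds v +_) pu≡0 ⟨
        (v + - u) · evalMonic ds v + evalMonic (c ∷ cs) u       ≡⟨ p≡ v ⟨
        evalMonic (c ∷ cs) v                                    ≡⟨ pv≡0 ⟩
        0#                                                      ∎)
      ... | inj₁ v-u≡0 = contradiction (sym (x∙y⁻¹≈ε⇒x≈y v u v-u≡0)) u≢v
      ... | inj₂ qv≡0 = qv≡0

  evalMonic-zeros : ∀ N x → evalMonic (replicate N 0#) x ≡ x ^ N
  evalMonic-zeros zero x = refl
  evalMonic-zeros (suc N) x = trans (+-identityʳ _) (cong (x ·_) (evalMonic-zeros N x))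

  rootsOfUnity≤ : ∀ N → N ≢ 0 → (us : List F) → Unique us → All (λ u → u ^ N ≡ 1#) us → length us ≤ N
  rootsOfUnity≤ zero N≢0 _ _ _ = contradiction refl N≢0
  rootsOfUnity≤ (suc N) _ us uniq us^N≡1 =
    subst (length us ≤_) (cong suc (length-replicate N)) (roots≤degree (- 1# ∷ replicate N 0#) us uniq (All.map root us^N≡1))
    where
      root : ∀ {u} → u ^ suc N ≡ 1# → evalMonic (- 1# ∷ replicate N 0#) u ≡ 0#
      root {u} u^N≡1 = begin
        u · evalMonic (replicate N 0#) u + - 1#    ≡⟨ cong (λ p → u · p + - 1#) (evalMonic-zeros N u) ⟩
        u ^ suc N + - 1#                           ≡⟨ cong (_+ - 1#) u^N≡1 ⟩
        1# + - 1#                                  ≡⟨ -‿inverseʳ 1# ⟩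
        0#                                         ∎

  product-nonZero : ∀ {k} (z : Fin k → F) → (∀ i → z i ≢ 0#) → product z ≢ 0#
  product-nonZero {zero}  z z≢0 = 1#≢0#
  product-nonZero {suc k} z z≢0 = ·-nonZero (z≢0 zero) (product-nonZero (z ∘ suc) (z≢0 ∘ suc))

  scaling-permutation⇒^≡1 : ∀ {k} (z : Fin k → F) (σ : Fin k ↔ Fin k) {s} → (∀ i → z i ≢ 0#) →
                            (∀ i → s · z i ≡ z (Inverse.to σ i)) → s ^ k ≡ 1#
  scaling-permutation⇒^≡1 {k} z σ {s} z≢0 sz≡zσ = ·-cancelʳ (product-nonZero z z≢0) (begin
    s ^ k · product z                    ≡⟨ cong (_· product z) (sum-replicate k {s}) ⟨
    product {k} (λ _ → s) · product z    ≡⟨ ∑-distrib-+ (λ _ → s) z ⟨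
    product (λ i → s · z i)              ≡⟨ sum-cong-≗ sz≡zσ ⟩
    product (z ∘ Inverse.to σ)           ≡⟨ sum-permute z σ ⟨
    product z                            ≡⟨ *-identityˡ (product z) ⟨
    1# · product z                       ∎)

  ScalesInto : ∀ {k} → (Fin k → F) → F → Set
  ScalesInto z w = ∀ i → ∃ λ i′ → w · z i ≡ z i′

  scalesInto-· : ∀ {k} {z : Fin k → F} {a b} → ScalesInto z a → ScalesInto z b → ScalesInto z (a · b)
  scalesInto-· {a = a} {b} az⊆z bz⊆z i with bz⊆z i
  ... | i′ , bzi≡zi′ with az⊆z i′
  ...   | i″ , azi′≡zi″ = i″ , trans (*-assoc a b _) (trans (cong (a ·_) bzi≡zi′) azi′≡zi″)

  scalesInto-^ : ∀ {k} {z : Fin k → F} {a} → ScalesInto z a → ∀ n → ScalesInto z (a ^ n)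
  scalesInto-^ az⊆z zero    i = i , *-identityˡ _
  scalesInto-^ az⊆z (suc n) = scalesInto-· az⊆z (scalesInto-^ az⊆z n)

  -- An element of 2-power order other than 1 has -1 among its powers.
  scalesInto-2-power⇒≡1 : ∀ {k} {z : Fin k → F} → ¬ ScalesInto z (- 1#) →
                          ∀ {w} → ScalesInto z w → ∀ e → w ^ (2 ℕ.^ e) ≡ 1# → w ≡ 1#
  scalesInto-2-power⇒≡1 _ {w} _ zero w^1≡1 = trans (sym (*-identityʳ w)) w^1≡1
  scalesInto-2-power⇒≡1 ¬-1z⊆z {w} wz⊆z (suc e) w^2^e≡1
    with x·x≡1⇒x≡±1 w (trans (cong (w ·_) (sym (*-identityʳ w))) w²≡1)
    where
      w²≡1 : w ^ 2 ≡ 1#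
      w²≡1 = scalesInto-2-power⇒≡1 ¬-1z⊆z (scalesInto-^ wz⊆z 2) e (trans (^-assocʳ w 2 (2 ℕ.^ e)) w^2^e≡1)
  ... | inj₁ w≡1 = w≡1
  ... | inj₂ w≡-1 = contradiction (subst (ScalesInto _) w≡-1 wz⊆z) ¬-1z⊆z

  scalesInto-^oddPart≡1 : ∀ {k} {z : Fin k → F} → ¬ ScalesInto z (- 1#) →
                          ∀ {s} → ScalesInto z s → s ^ k ≡ 1# → s ^ oddPart k ≡ 1#
  scalesInto-^oddPart≡1 {k} ¬-1z⊆z {s} sz⊆z s^k≡1 with oddPart*2^≡ k
  ... | e , o*2^e≡k = scalesInto-2-power⇒≡1 ¬-1z⊆z (scalesInto-^ sz⊆z (oddPart k)) e (begin
    (s ^ oddPart k) ^ (2 ℕ.^ e)     ≡⟨ ^-assocʳ s (oddPart k) (2 ℕ.^ e) ⟩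
    s ^ (oddPart k ℕ.* 2 ℕ.^ e)     ≡⟨ cong (s ^_) o*2^e≡k ⟩
    s ^ k                           ≡⟨ s^k≡1 ⟩
    1#                              ∎)

  stabilizer⇒permutation : ∀ {k} {z : Fin k → F} → Injective _≡_ _≡_ z → ∀ {s} → InStabilizer 𝔽 z s →
                           Σ (Fin k ↔ Fin k) λ σ → ∀ i → s · z i ≡ z (Inverse.to σ i)
  stabilizer⇒permutation {k} {z} z-injective {s} (s≢0 , sz⊆z , z⊆sz) =
    mk↔ₛ′ to from to∘from from∘to , λ i → proj₂ (sz⊆z i)
    where
      to from : Fin k → Fin k
      to i = proj₁ (sz⊆z i)
      from i = proj₁ (z⊆sz i)
      to∘from : ∀ i → to (from i) ≡ i
      to∘from i = z-injective (trans (sym (proj₂ (sz⊆z (from i)))) (sym (proj₂ (z⊆sz i))))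
      from∘to : ∀ i → from (to i) ≡ i
      from∘to i = z-injective (·-cancelˡ s≢0 (trans (sym (proj₂ (z⊆sz (to i)))) (sym (proj₂ (sz⊆z i)))))

  permutation⇒stabilizer : ∀ {k} {z : Fin k → F} {s} → s ≢ 0# → (σ : Fin k ↔ Fin k) →
                           (∀ i → s · z i ≡ z (Inverse.to σ i)) → InStabilizer 𝔽 z s
  permutation⇒stabilizer {z = z} s≢0 σ sz≡zσ =
    s≢0 , (λ i → Inverse.to σ i , sz≡zσ i) ,
    (λ i → Inverse.from σ i , sym (trans (sz≡zσ _) (cong z (Inverse.strictlyInverseˡ σ i))))

  stabilizer^oddPart≡1 : ∀ {k} {z : Fin k → F} → Injective _≡_ _≡_ z → (∀ i → z i ≢ 0#) →
                         ¬ ScalesInto z (- 1#) → ∀ {s} → InStabilizer 𝔽 z s → s ^ oddPart k ≡ 1#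
  stabilizer^oddPart≡1 {z = z} z-injective z≢0 ¬-1z⊆z stab with stabilizer⇒permutation z-injective stab
  ... | σ , sz≡zσ = scalesInto-^oddPart≡1 ¬-1z⊆z (proj₁ (proj₂ stab)) (scaling-permutation⇒^≡1 z σ z≢0 sz≡zσ)

  -- 0#, the ℓ elements L a and the ℓ elements - L a cover all q = 1 + 2ℓ elements, so they are distinct.
  halfSet-noNegatives : ∀ {ℓ} {L : Fin ℓ → F} → q ≡ suc (ℓ ℕ.+ ℓ) → IsHalfSet 𝔽 L → ∀ a b → L a ≢ - L b
  halfSet-noNegatives {ℓ} {L} q≡1+2ℓ (_ , covers) a b La≡-Lb =
    inj₁≢inj₂ (cong (splitAt ℓ) (suc-injective (strictlySurjective⇒injective (sym q≡1+2ℓ) Φ Φ-surjective Φ-collision)))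
    where
      ±L : Fin ℓ ⊎ Fin ℓ → F
      ±L = [ L , -_ ∘ L ]′

      Φ : Fin (suc (ℓ ℕ.+ ℓ)) → F
      Φ zero    = 0#
      Φ (suc k) = ±L (splitAt ℓ k)

      Φ-surjective : StrictlySurjective _≡_ Φ
      Φ-surjective y with y Fin.≟ 0#
      ... | yes y≡0 = zero , sym y≡0
      ... | no y≢0 with proj₁ (covers y) y≢0
      ...   | c , inj₁ Lc≡y  = suc (c ↑ˡ ℓ) , trans (cong ±L (splitAt-↑ˡ ℓ c ℓ)) Lc≡y
      ...   | c , inj₂ Lc≡-y = suc (ℓ ↑ʳ c) , trans (cong ±L (splitAt-↑ʳ ℓ ℓ c)) (trans (cong -_ Lc≡-y) (⁻¹-involutive y))

      Φ-collision : Φ (suc (a ↑ˡ ℓ)) ≡ Φ (suc (ℓ ↑ʳ b))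
      Φ-collision = trans (cong ±L (splitAt-↑ˡ ℓ a ℓ)) (trans La≡-Lb (sym (cong ±L (splitAt-↑ʳ ℓ ℓ b))))

      inj₁≢inj₂ : splitAt ℓ (a ↑ˡ ℓ) ≢ splitAt ℓ (ℓ ↑ʳ b)
      inj₁≢inj₂ eq with trans (sym (splitAt-↑ˡ ℓ a ℓ)) (trans eq (splitAt-↑ʳ ℓ ℓ b))
      ... | ()

  -- Cancelling along the row i₀ and the column j₀ gives s := x (σ i₀) / x i₀ and t := y (τ j₀) / y j₀.
  scaling-factors : ∀ {m n} {x : Fin m → F} {y : Fin n → F} {σ : Fin m → Fin m} {τ : Fin n → Fin n} {u} →
                    (∀ i → x i ≢ 0#) → (∀ j → y j ≢ 0#) → Fin m → Fin n →
                    (∀ i j → u · (x i · y j) ≡ x (σ i) · y (τ j)) →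
                    ∃₂ λ s t → (∀ i → s · x i ≡ x (σ i)) × (∀ j → t · y j ≡ y (τ j)) × u ≡ s · t
  scaling-factors {x = x} {y} {σ} {τ} {u} x≢0 y≢0 i₀ j₀ uxy≡xσyτ
    with quotient (x≢0 i₀) (x (σ i₀)) | quotient (y≢0 j₀) (y (τ j₀))
  ... | s , sx₀≡xσ₀ | t , ty₀≡yτ₀ = s , t , sx≡xσ , ty≡yτ , u≡st
    where
      u≡st : u ≡ s · t
      u≡st = ·-cancelʳ (·-nonZero (x≢0 i₀) (y≢0 j₀)) (begin
        u · (x i₀ · y j₀)         ≡⟨ uxy≡xσyτ i₀ j₀ ⟩
        x (σ i₀) · y (τ j₀)       ≡⟨ cong₂ _·_ sx₀≡xσ₀ ty₀≡yτ₀ ⟨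
        (s · x i₀) · (t · y j₀)   ≡⟨ interchange s (x i₀) t (y j₀) ⟩
        (s · t) · (x i₀ · y j₀)   ∎)

      sx≡xσ : ∀ i → s · x i ≡ x (σ i)
      sx≡xσ i = ·-cancelʳ (subst (_≢ 0#) (sym ty₀≡yτ₀) (y≢0 (τ j₀))) (begin
        (s · x i) · (t · y j₀)    ≡⟨ interchange s (x i) t (y j₀) ⟩
        (s · t) · (x i · y j₀)    ≡⟨ cong (_· (x i · y j₀)) u≡st ⟨
        u · (x i · y j₀)          ≡⟨ uxy≡xσyτ i j₀ ⟩
        x (σ i) · y (τ j₀)        ≡⟨ cong (x (σ i) ·_) ty₀≡yτ₀ ⟨
        x (σ i) · (t · y j₀)      ∎)

      ty≡yτ : ∀ j → t · y j ≡ y (τ j)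
      ty≡yτ j = ·-cancelˡ (subst (_≢ 0#) (sym sx₀≡xσ₀) (x≢0 (σ i₀))) (begin
        (s · x i₀) · (t · y j)    ≡⟨ interchange s (x i₀) t (y j) ⟩
        (s · t) · (x i₀ · y j)    ≡⟨ cong (_· (x i₀ · y j)) u≡st ⟨
        u · (x i₀ · y j)          ≡⟨ uxy≡xσyτ i₀ j ⟩
        x (σ i₀) · y (τ j)        ≡⟨ cong (_· y (τ j)) sx₀≡xσ₀ ⟨
        (s · x i₀) · y (τ j)      ∎)

  module RankOneHeffter {m n} (q≡1+2mn : q ≡ suc (m ℕ.* n ℕ.+ m ℕ.* n))
    {A : Fin m → Fin n → F} (heffter : IsHeffter 𝔽 m n A)
    {x : Fin m → F} {y : Fin n → F} (x≢0 : ∀ i → x i ≢ 0#) (y≢0 : ∀ j → y j ≢ 0#)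
    (A≡xy : ∀ i j → A i j ≡ x i · y j) (i₀ : Fin m) (j₀ : Fin n) where

    listing : Fin (m ℕ.* n) → F
    listing k = A (proj₂ (quotRem {m} n k)) (proj₁ (quotRem {m} n k))

    listing-halfSet : IsHalfSet 𝔽 listing
    listing-halfSet = proj₁ heffter

    listing-combine : ∀ i j → listing (combine i j) ≡ A i j
    listing-combine i j = cong (λ p → A (proj₁ p) (proj₂ p)) (remQuot-combine i j)

    entries-injective : ∀ {i j i′ j′} → A i j ≡ A i′ j′ → i ≡ i′ × j ≡ j′
    entries-injective {i} {j} {i′} {j′} Aij≡Ai′j′ = combine-injective i j i′ j′
      (proj₁ listing-halfSet _ _ (trans (listing-combine i j) (trans Aij≡Ai′j′ (sym (listing-combine i′ j′)))))

    entries-noNegatives : ∀ i j i′ j′ → A i′ j′ ≢ - A i j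
    entries-noNegatives i j i′ j′ Ai′j′≡-Aij =
      halfSet-noNegatives q≡1+2mn listing-halfSet (combine i′ j′) (combine i j)
        (trans (listing-combine i′ j′) (trans Ai′j′≡-Aij (cong -_ (sym (listing-combine i j)))))

    x-injective : Injective _≡_ _≡_ x
    x-injective {i} {i′} xi≡xi′ = proj₁ (entries-injective
      (trans (A≡xy i j₀) (trans (cong (_· y j₀) xi≡xi′) (sym (A≡xy i′ j₀)))))

    y-injective : Injective _≡_ _≡_ y
    y-injective {j} {j′} yj≡yj′ = proj₂ (entries-injective
      (trans (A≡xy i₀ j) (trans (cong (x i₀ ·_) yj≡yj′) (sym (A≡xy i₀ j′)))))

    ¬-1·x⊆x : ¬ ScalesInto x (- 1#)
    ¬-1·x⊆x -x⊆x with -x⊆x i₀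
    ... | i′ , -1·xi₀≡xi′ = entries-noNegatives i₀ j₀ i′ j₀ (begin
      A i′ j₀                  ≡⟨ A≡xy i′ j₀ ⟩
      x i′ · y j₀              ≡⟨ cong (_· y j₀) (trans (sym -1·xi₀≡xi′) (-1*x≈-x (x i₀))) ⟩
      - x i₀ · y j₀            ≡⟨ -‿distribˡ-* (x i₀) (y j₀) ⟨
      - (x i₀ · y j₀)          ≡⟨ cong -_ (A≡xy i₀ j₀) ⟨
      - A i₀ j₀                ∎)

    ¬-1·y⊆y : ¬ ScalesInto y (- 1#)
    ¬-1·y⊆y -y⊆y with -y⊆y j₀
    ... | j′ , -1·yj₀≡yj′ = entries-noNegatives i₀ j₀ i₀ j′ (begin
      A i₀ j′                  ≡⟨ A≡xy i₀ j′ ⟩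
      x i₀ · y j′              ≡⟨ cong (x i₀ ·_) (trans (sym -1·yj₀≡yj′) (-1*x≈-x (y j₀))) ⟩
      x i₀ · - y j₀            ≡⟨ -‿distribʳ-* (x i₀) (y j₀) ⟨
      - (x i₀ · y j₀)          ≡⟨ cong -_ (A≡xy i₀ j₀) ⟨
      - A i₀ j₀                ∎)

    InStabilizerProduct : F → Set
    InStabilizerProduct u = Σ F λ s → Σ F λ t → InStabilizer 𝔽 x s × InStabilizer 𝔽 y t × u ≡ s · t

    stabilizers⇒multiplier : ∀ {u} → InStabilizerProduct u → IsMultiplier 𝔽 A u
    stabilizers⇒multiplier {u} (s , t , x-stab , y-stab , u≡st)
      with stabilizer⇒permutation x-injective x-stab | stabilizer⇒permutation y-injective y-stab
    ... | σ , sx≡xσ | τ , ty≡yτ =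
      subst (_≢ 0#) (sym u≡st) (·-nonZero (proj₁ x-stab) (proj₁ y-stab)) , inj₁ (σ , τ , λ i j → begin
        u · A i j                                    ≡⟨ cong₂ _·_ u≡st (A≡xy i j) ⟩
        (s · t) · (x i · y j)                        ≡⟨ interchange s t (x i) (y j) ⟩
        (s · x i) · (t · y j)                        ≡⟨ cong₂ _·_ (sx≡xσ i) (ty≡yτ j) ⟩
        x (Inverse.to σ i) · y (Inverse.to τ j)      ≡⟨ A≡xy _ _ ⟨
        A (Inverse.to σ i) (Inverse.to τ j)          ∎)

    multiplier⇒stabilizers : ∀ {u} → IsMultiplier 𝔽 A u → InStabilizerProduct u
    multiplier⇒stabilizers {u} (_ , inj₁ (σ , τ , uA≡Aστ))
      with scaling-factors x≢0 y≢0 i₀ j₀ (λ i j → trans (cong (u ·_) (sym (A≡xy i j))) (trans (uA≡Aστ i j) (A≡xy _ _)))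
    ... | s , t , sx≡xσ , ty≡yτ , u≡st =
      s , t , permutation⇒stabilizer (x·y≢0⇒x≢0 (subst (_≢ 0#) (sym (sx≡xσ i₀)) (x≢0 _))) σ sx≡xσ ,
              permutation⇒stabilizer (x·y≢0⇒x≢0 (subst (_≢ 0#) (sym (ty≡yτ j₀)) (y≢0 _))) τ ty≡yτ , u≡st
    multiplier⇒stabilizers {u} (u≢0 , inj₂ (π , ρ , uA≡Aᵀπρ)) =
      u , 1# , permutation⇒stabilizer u≢0 (π ↔-∘ ρ) ux≡xπρ ,
               permutation⇒stabilizer 1#≢0# (↔-id _) (λ j → *-identityˡ (y j)) , sym (*-identityʳ u)
      where
        ux≡xπρ : ∀ i → u · x i ≡ x (Inverse.to π (Inverse.to ρ i))
        ux≡xπρ i = ·-cancelʳ (y≢0 (Inverse.to ρ i)) (begin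
          u · x i · y (Inverse.to ρ i)                             ≡⟨ *-assoc u (x i) _ ⟩
          u · (x i · y (Inverse.to ρ i))                           ≡⟨ cong (u ·_) (A≡xy i _) ⟨
          u · A i (Inverse.to ρ i)                                 ≡⟨ uA≡Aᵀπρ i (Inverse.to ρ i) ⟩
          A (Inverse.to π (Inverse.to ρ i)) (Inverse.to ρ i)       ≡⟨ A≡xy _ _ ⟩
          x (Inverse.to π (Inverse.to ρ i)) · y (Inverse.to ρ i)   ∎)

    multiplier^lcm≡1 : ∀ {u} → IsMultiplier 𝔽 A u → u ^ lcm (oddPart m) (oddPart n) ≡ 1#
    multiplier^lcm≡1 {u} multiplier with multiplier⇒stabilizers multiplier
    ... | s , t , x-stab , y-stab , u≡st = begin
      u ^ N              ≡⟨ cong (_^ N) u≡st ⟩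
      (s · t) ^ N        ≡⟨ ^-distrib-* s t N ⟩
      s ^ N · t ^ N      ≡⟨ cong₂ _·_ (^≡1⇒^multiple≡1 (oddPart m) s^m≡1 (m∣lcm[m,n] (oddPart m) (oddPart n)))
                                      (^≡1⇒^multiple≡1 (oddPart n) t^n≡1 (n∣lcm[m,n] (oddPart m) (oddPart n))) ⟩
      1# · 1#            ≡⟨ *-identityˡ 1# ⟩
      1#                 ∎
      where
        N : ℕ
        N = lcm (oddPart m) (oddPart n)
        s^m≡1 : s ^ oddPart m ≡ 1#
        s^m≡1 = stabilizer^oddPart≡1 x-injective x≢0 ¬-1·x⊆x x-stab
        t^n≡1 : t ^ oddPart n ≡ 1#
        t^n≡1 = stabilizer^oddPart≡1 y-injective y≢0 ¬-1·y⊆y y-stab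

2*m*n≡mn+mn : ∀ m n → 2 * m * n ≡ m * n ℕ.+ m * n
2*m*n≡mn+mn m n = trans (ℕ.*-assoc 2 m n) (cong (m * n ℕ.+_) (ℕ.+-identityʳ (m * n)))

proposition3 : (m n q : ℕ) → q ≡ suc (2 * m * n) → IsPrimePower q →
    (𝔽 : FiniteField q) →
    (A : Fin m → Fin n → Fin q) → IsHeffter 𝔽 m n A →
    (x : Fin m → Fin q) → (y : Fin n → Fin q) →
    (∀ i → x i ≢ FiniteField.0# 𝔽) → (∀ j → y j ≢ FiniteField.0# 𝔽) →
    (∀ i j → A i j ≡ FiniteField._*_ 𝔽 (x i) (y j)) →
    (∀ u → IsMultiplier 𝔽 A u ⇔
      Σ (Fin q) λ s → Σ (Fin q) λ t →
        InStabilizer 𝔽 x s × InStabilizer 𝔽 y t × u ≡ FiniteField._*_ 𝔽 s t)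
    ×
    (∀ (us : List (Fin q)) → Unique us → All (IsMultiplier 𝔽 A) us →
      length us ≤ lcm (oddPart m) (oddPart n))
proposition3 zero n q q≡1 _ 𝔽 _ _ _ _ _ _ _ = ⊥-elim (no-field-of-order-1 q≡1 𝔽)
proposition3 (suc m) zero q q≡1+2mn _ 𝔽 _ _ _ _ _ _ _ =
  ⊥-elim (no-field-of-order-1 (trans q≡1+2mn (cong suc (ℕ.*-zeroʳ (2 * suc m)))) 𝔽)
proposition3 m@(suc _) n@(suc _) q q≡1+2mn _ 𝔽 A heffter x y x≢0 y≢0 A≡xy =
  (λ u → mk⇔ multiplier⇒stabilizers stabilizers⇒multiplier) ,
  (λ us uniq multipliers → rootsOfUnity≤ (lcm (oddPart m) (oddPart n))
                             (lcm≢0 (oddPart≢0 {m} (λ ())) (oddPart≢0 {n} (λ ())))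
                             us uniq (All.map multiplier^lcm≡1 multipliers))
  where
    open FieldProperties 𝔽
    open RankOneHeffter (trans q≡1+2mn (cong suc (2*m*n≡mn+mn m n))) heffter x≢0 y≢0 A≡xy zero zero
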